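{- Let $G=(V;E)$ be the random graph and let $e:V\to V$ be such that $e$ preserves $N$ but does not preserve $E$. Then $e_N$ belongs to the smallest locally closed monoid of maps $V\to V$ containing $e$ and $\mathrm{Aut}(G)$.
   Context: The random graph $G=(V;E)$ is the unique countably infinite graph such that for all finite disjoint $U,U'\subseteq V$ there is $v\in V\setminus(U\cup U')$ adjacent to all of $U$ and none of $U'$. $N(x,y)$ means $x\neq y$ and $x,y$ are not adjacent. A map $e$ preserves a binary relation $R$ if $R(x,y)$ implies $R(e(x),e(y))$. A monoid of maps $V\to V$ is locally closed if it is closed in the product topology on $V^V$ ($V$ discrete). $e_N$ is a fixed injective map $V\to V$ whose image induces an infinite independent set in $G$. -}

module Defs where

open import Data.Nat using (ℕ; zero; suc; _<_; _/_; _%_)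
open import Data.Product using (Σ; _×_; _,_)
open import Data.Sum using (_⊎_)
open import Data.List using (List)
open import Data.List.Relation.Unary.All using (All)
open import Relation.Nullary using (¬_)
open import Relation.Binary.PropositionalEquality using (_≡_; _≢_)
open import Function using (_∘_; id)

V : Set
V = ℕ

Bit : ℕ → ℕ → Set
Bit zero    n = n % 2 ≡ 1
Bit (suc i) n = Bit i (n / 2)

-- Rado's model of the random graph: for x < y, x and y are adjacent
-- iff the x-th binary digit of y is 1.  (Irreflexive and symmetric.)
E : V → V → Set
E x y = (x < y × Bit x y) ⊎ (y < x × Bit y x)

N : V → V → Set
N x y = x ≢ y × ¬ E x y

Preserves : (V → V) → (V → V → Set) → Set
Preserves e R = ∀ x y → R x y → R (e x) (e y)

IsAut : (V → V) → Set
IsAut f = Σ (V → V) λ g →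
  (∀ x → g (f x) ≡ x) × (∀ y → f (g y) ≡ y) ×
  (∀ x y → E x y → E (f x) (f y)) × (∀ x y → E (f x) (f y) → E x y)

IsMonoid : ((V → V) → Set) → Set
IsMonoid M = M id × (∀ f g → M f → M g → M (f ∘ g))

-- Locally closed: closed in the product topology on V^V (V discrete),
-- i.e. if every finite restriction of f is matched by some member of M,
-- then f ∈ M.
LocallyClosed : ((V → V) → Set) → Set
LocallyClosed M = ∀ f →
  (∀ (F : List V) → Σ (V → V) λ g → M g × All (λ x → g x ≡ f x) F) → M f

InClosedMonoidGen : (V → V) → (V → V) → Set₁
InClosedMonoidGen e f =
  (M : (V → V) → Set) → IsMonoid M → LocallyClosed M →
  M e → (∀ a → IsAut a → M a) → M f

IsEN : (V → V) → Set
IsEN eN = (∀ x y → eN x ≡ eN y → x ≡ y) × (∀ x y → ¬ E (eN x) (eN y))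

-- If e identifies the endpoints of the given edge, a vertex adjacent to one endpoint only gives an
-- edge that e maps into N.  Back-and-forth extends any finite partial isomorphism to an automorphism,
-- and the forth steps can choose images on which e stays injective; so some e ∘ α sends a given edge
-- onto a non-edge while keeping a given finite set injective, and composing finitely many such maps
-- (all preserving non-adjacency) makes any finite F independent.  An automorphism then moves the
-- image of F onto eN F, so the monoid meets every basic neighbourhood of eN, and local closure puts eN in it.

module Submission where

open import Defs
open import Data.Bool.Base using (Bool; true; false; T)
open import Data.Empty using (⊥-elim)
open import Data.List.Base using (List; []; _∷_; map; cartesianProduct)
open import Data.List.Extrema.Nat using (max; xs≤max)
open import Data.List.Membership.Propositional using (_∈_; _∉_; find; lose)
open import Data.List.Membership.Propositional.Properties using (∈-map⁺; ∈-map⁻; ∈-cartesianProduct⁺)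
open import Data.List.Relation.Binary.Subset.Propositional using (_⊆_)
open import Data.List.Relation.Unary.All as All using (All)
open import Data.List.Relation.Unary.Any using (Any; here; there; any?)
open import Data.Nat.Base using (ℕ; zero; suc; _+_; _*_; _<_; _≤_; _≤′_; ≤′-refl; ≤′-step; _⊔_; _/_; _%_; z≤n; s≤s)
open import Data.Nat.DivMod using (m*n%n≡0; [m+kn]%n≡m%n; m*n/n≡m; +-distrib-/-∣ʳ; m/n<m)
open import Data.Nat.Divisibility using (divides)
open import Data.Nat.Properties
open import Data.List.Membership.DecPropositional _≟_ using (_∈?_)
open import Data.Product using (Σ; ∃; ∃-syntax; _×_; _,_; proj₁; proj₂; swap)
open import Data.Sum using (inj₁; inj₂)
open import Function using (_∘_; id; _⇔_; mk⇔; Equivalence)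
open import Function.Construct.Symmetry using (⇔-sym)
open import Relation.Binary.PropositionalEquality
open import Relation.Nullary using (¬_; Dec; yes; no)
open import Relation.Nullary.Decidable using (isYes; toWitness; fromWitness; _×-dec_; _⊎-dec_)
open import Relation.Unary using (Decidable)

open Equivalence using (to; from)

Bit? : ∀ i n → Dec (Bit i n)
Bit? zero    n = n % 2 ≟ 1
Bit? (suc i) n = Bit? i (n / 2)

E? : ∀ x y → Dec (E x y)
E? x y = (x <? y ×-dec Bit? x y) ⊎-dec (y <? x ×-dec Bit? y x)

E-irrefl : ∀ {x} → ¬ E x x
E-irrefl (inj₁ (x<x , _)) = <-irrefl refl x<x
E-irrefl (inj₂ (x<x , _)) = <-irrefl refl x<x

E-sym : ∀ {x y} → E x y → E y x
E-sym (inj₁ p) = inj₂ p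
E-sym (inj₂ p) = inj₁ p

E⇒≢ : ∀ {x y} → E x y → x ≢ y
E⇒≢ exy refl = E-irrefl exy

E⇔Bit : ∀ {x y} → x < y → E x y ⇔ Bit x y
E⇔Bit {x} {y} x<y = mk⇔ bit (λ b → inj₁ (x<y , b))
  where
  bit : E x y → Bit x y
  bit (inj₁ (_ , b))   = b
  bit (inj₂ (y<x , _)) = ⊥-elim (<-asym x<y y<x)

Bit⇒0< : ∀ i n → Bit i n → 0 < n
Bit⇒0< zero    (suc n) _ = s≤s z≤n
Bit⇒0< (suc i) (suc n) _ = s≤s z≤n
Bit⇒0< (suc i) zero    b with () ← Bit⇒0< i 0 b

Bit⇒< : ∀ i n → Bit i n → i < n
Bit⇒< zero    n       b = Bit⇒0< zero n b
Bit⇒< (suc i) zero    b with () ← Bit⇒0< i 0 b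
Bit⇒< (suc i) (suc n) b = ≤-<-trans (Bit⇒< i (suc n / 2) b) (m/n<m (suc n) 2 (s≤s (s≤s z≤n)))

digit : Bool → ℕ
digit false = 0
digit true  = 1

digit-half : ∀ b m → (digit b + m * 2) / 2 ≡ m
digit-half false m = m*n/n≡m m 2
digit-half true  m = trans (+-distrib-/-∣ʳ 1 {m * 2} {2} (divides m refl)) (m*n/n≡m m 2)

Bit-zero-digit : ∀ b m → Bit 0 (digit b + m * 2) ⇔ T b
Bit-zero-digit false m = mk⇔ (λ odd → 0≢1+n (trans (sym (m*n%n≡0 m 2)) odd)) λ ()
Bit-zero-digit true  m = mk⇔ _ (λ _ → [m+kn]%n≡m%n 1 m 2)

-- Binary digits φ 0, …, φ (n - 1), then a leading 1 in position n, which makes the number exceed n.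
withBits : (ℕ → Bool) → ℕ → ℕ
withBits φ zero    = 1
withBits φ (suc n) = digit (φ 0) + withBits (φ ∘ suc) n * 2

Bit-withBits-top : ∀ φ n → Bit n (withBits φ n)
Bit-withBits-top φ zero    = refl
Bit-withBits-top φ (suc n) =
  subst (Bit n) (sym (digit-half (φ 0) (withBits (φ ∘ suc) n))) (Bit-withBits-top (φ ∘ suc) n)

Bit-withBits : ∀ φ {n j} → j < n → Bit j (withBits φ n) ⇔ T (φ j)
Bit-withBits φ {suc n} {zero}  _         = Bit-zero-digit (φ 0) (withBits (φ ∘ suc) n)
Bit-withBits φ {suc n} {suc j} (s≤s j<n) =
  subst (λ k → Bit j k ⇔ T (φ (suc j))) (sym (digit-half (φ 0) (withBits (φ ∘ suc) n))) (Bit-withBits (φ ∘ suc) j<n)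

extension : ∀ m {P : V → Set} → Decidable P → ∃[ v ] m < v × (∀ {d} → d < m → E d v ⇔ P d)
extension m P? = v , m<v , λ d<m → mk⇔
    (λ edv → toWitness (to (Bit-withBits φ d<m) (to (E⇔Bit (<-trans d<m m<v)) edv)))
    (λ pd → from (E⇔Bit (<-trans d<m m<v)) (from (Bit-withBits φ d<m) (fromWitness pd)))
  where
  φ = isYes ∘ P?
  v = withBits φ m
  m<v = Bit⇒< m v (Bit-withBits-top φ m)

edge-to-N : ∀ {e} → Preserves e N → (∃[ x ] ∃[ y ] E x y × ¬ E (e x) (e y)) → ∃[ x ] ∃[ y ] E x y × N (e x) (e y)
edge-to-N {e} e-N (x , y , Exy , ¬Eexy) with e x ≟ e y | extension (suc (x ⊔ y)) (_≟ x)
... | no  ex≢ey | _ = x , y , Exy , ex≢ey , ¬Eexy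
... | yes ex≡ey | z , bound<z , link = z , x , E-sym Exz , subst (N (e z)) (sym ex≡ey) (e-N z y Nzy)
  where
  x<bound = s≤s (m≤m⊔n x y)
  y<bound = s≤s (m≤n⊔m x y)
  Exz : E x z
  Exz = from (link x<bound) refl
  Nzy : N z y
  Nzy = (λ z≡y → <-irrefl (sym z≡y) (<-trans y<bound bound<z))
      , λ Ezy → E⇒≢ Exy (sym (to (link y<bound) (E-sym Ezy)))

PartialMap : Set
PartialMap = List (V × V)

dom ran : PartialMap → List V
dom = map proj₁
ran = map proj₂

IsPartialIso : PartialMap → Set
IsPartialIso P = ∀ {a b c d} → (a , b) ∈ P → (c , d) ∈ P → (a ≡ c ⇔ b ≡ d) × (E a c ⇔ E b d)

∈-dom : ∀ {u P} → u ∈ dom P → ∃[ w ] (u , w) ∈ P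
∈-dom u∈ with ∈-map⁻ proj₁ u∈
... | (u , w) , i , refl = w , i

∷-isPartialIso : ∀ {P u v} → IsPartialIso P →
  (∀ {c d} → (c , d) ∈ P → (c ≡ u ⇔ d ≡ v) × (E c u ⇔ E d v)) → IsPartialIso ((u , v) ∷ P)
∷-isPartialIso iso new (here refl) (here refl) =
  mk⇔ (λ _ → refl) (λ _ → refl) , mk⇔ (⊥-elim ∘ E-irrefl) (⊥-elim ∘ E-irrefl)
∷-isPartialIso iso new (here refl) (there q)   = let c≡u , Ecu = new q in
  mk⇔ (sym ∘ to c≡u ∘ sym) (sym ∘ from c≡u ∘ sym) , mk⇔ (E-sym ∘ to Ecu ∘ E-sym) (E-sym ∘ from Ecu ∘ E-sym)
∷-isPartialIso iso new (there p)   (here refl) = new p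
∷-isPartialIso iso new (there p)   (there q)   = iso p q

swap-isPartialIso : ∀ {P} → IsPartialIso P → IsPartialIso (map swap P)
swap-isPartialIso iso p q with ∈-map⁻ swap p | ∈-map⁻ swap q
... | _ , p′ , refl | _ , q′ , refl = let a≡c , Eac = iso p′ q′ in ⇔-sym a≡c , ⇔-sym Eac

∈-swap : ∀ {P : PartialMap} {a b} → (a , b) ∈ P → (b , a) ∈ map swap P
∈-swap = ∈-map⁺ swap

bound : PartialMap → ℕ
bound P = suc (max 0 (ran P))

ran<bound : ∀ {P c d} → (c , d) ∈ P → d < bound P
ran<bound {P} i = s≤s (All.lookup (xs≤max 0 (ran P)) (∈-map⁺ proj₂ i))

module Forth (P : PartialMap) (u : V) where

  ImageOfNeighbour : V → Set
  ImageOfNeighbour d = Any (λ (c , d′) → d′ ≡ d × E c u) P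

  imageOfNeighbour? : Decidable ImageOfNeighbour
  imageOfNeighbour? d = any? (λ (c , d′) → d′ ≟ d ×-dec E? c u) P

  Realises : ℕ → V → Set
  Realises m v = m < v × (∀ {d} → d < m → E d v ⇔ ImageOfNeighbour d)

  realiser : ∀ m → ∃ (Realises m)
  realiser m = extension m imageOfNeighbour?

  Realises-mono : ∀ {m m′ v} → m ≤ m′ → Realises m′ v → Realises m v
  Realises-mono m≤m′ (m′<v , link) = <-≤-trans (s≤s m≤m′) m′<v , link ∘ λ d<m → <-≤-trans d<m m≤m′

  realiser-extends : ∀ {m v} → IsPartialIso P → u ∉ dom P → bound P ≤ m → Realises m v → IsPartialIso ((u , v) ∷ P)
  realiser-extends {m} {v} iso u∉ bound≤m (m<v , link) = ∷-isPartialIso iso λ i →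
      mk⇔ (λ { refl → ⊥-elim (u∉ (∈-map⁺ proj₁ i)) }) (λ { refl → ⊥-elim (<-asym (d<m i) m<v) })
    , mk⇔ (λ Ecu → from (link (d<m i)) (lose i (refl , Ecu))) (λ Edv → adjacent i (to (link (d<m i)) Edv))
    where
    d<m : ∀ {c d} → (c , d) ∈ P → d < m
    d<m i = <-≤-trans (ran<bound i) bound≤m
    adjacent : ∀ {c d} → (c , d) ∈ P → ImageOfNeighbour d → E c u
    adjacent i image with find image
    ... | _ , j , refl , Ec′u = subst (λ c → E c u) (from (proj₁ (iso j i)) refl) Ec′u

  -- v ≥ bound P is not in the range of P, so a realiser above v is not adjacent to it.
  realisers-N : ∀ {m v w} → bound P ≤ m → Realises m v → Realises (suc v) w → N v w
  realisers-N {m} {v} bound≤m (m<v , _) (v<w , link) = <⇒≢ (<⇒≤ v<w) , λ Evw → notImage (to (link (n<1+n v)) Evw)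
    where
    notImage : ¬ ImageOfNeighbour v
    notImage image with find image
    ... | _ , i , refl , _ = <-asym (<-≤-trans (ran<bound i) bound≤m) m<v

InjectiveOn : (V → V) → List V → Set
InjectiveOn f L = ∀ {u v} → u ∈ L → v ∈ L → f u ≡ f v → u ≡ v

InjectiveOn-∷ : ∀ {f v L} → f v ∉ map f L → InjectiveOn f L → InjectiveOn f (v ∷ L)
InjectiveOn-∷             fresh inj (here refl) (here refl) _  = refl
InjectiveOn-∷ {f} {L = L} fresh inj (here refl) (there j)   eq = ⊥-elim (fresh (subst (_∈ map f L) (sym eq) (∈-map⁺ f j)))
InjectiveOn-∷ {f} {L = L} fresh inj (there i)   (here refl) eq = ⊥-elim (fresh (subst (_∈ map f L) eq (∈-map⁺ f i)))
InjectiveOn-∷             fresh inj (there i)   (there j)   eq = inj i j eq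

InjectiveOn-⊆ : ∀ {f L L′} → L ⊆ L′ → InjectiveOn f L′ → InjectiveOn f L
InjectiveOn-⊆ L⊆L′ inj i j = inj (L⊆L′ i) (L⊆L′ j)

InjectiveOn-∘ : ∀ {f g L} → InjectiveOn g L → InjectiveOn f (map g L) → InjectiveOn (f ∘ g) L
InjectiveOn-∘ {g = g} injg injf i j = injg i j ∘ injf (∈-map⁺ g i) (∈-map⁺ g j)

IndependentOn : (V → V) → List V → Set
IndependentOn f L = ∀ {u v} → u ∈ L → v ∈ L → ¬ E (f u) (f v)

NonAdjacent : V → V → Set
NonAdjacent x y = ¬ E x y

Preserves-∘ : ∀ {f g R} → Preserves f R → Preserves g R → Preserves (f ∘ g) R
Preserves-∘ pf pg x y = pf _ _ ∘ pg x y

N⇒NonAdjacent : ∀ {f} → Preserves f N → Preserves f NonAdjacent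
N⇒NonAdjacent {f} pf x y ¬Exy with x ≟ y
... | yes refl = E-irrefl
... | no  x≢y  = proj₂ (pf x y (x≢y , ¬Exy))

aut-injective : ∀ {α} → IsAut α → ∀ {u v} → α u ≡ α v → u ≡ v
aut-injective (α⁻¹ , α⁻¹∘α , _) {u} {v} eq = trans (sym (α⁻¹∘α u)) (trans (cong α⁻¹ eq) (α⁻¹∘α v))

aut-N : ∀ {α} → IsAut α → Preserves α N
aut-N isAut@(_ , _ , _ , _ , reflects) x y (x≢y , ¬Exy) = x≢y ∘ aut-injective isAut , ¬Exy ∘ reflects x y

module InjectiveForth (e : V → V) (e-N : Preserves e N) (P : PartialMap) (u : V) where

  open Forth P u

  -- A realiser v with e v = t is N-related to any realiser above it, so the image of the latter differs from t.
  avoiding : ∀ T {m} → bound P ≤ m → ∃[ v ] Realises m v × e v ∉ T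
  avoiding []      {m} _ = proj₁ (realiser m) , proj₂ (realiser m) , λ ()
  avoiding (t ∷ T) bound≤m with avoiding T bound≤m
  ... | v , realises , ev∉T with e v ≟ t
  ...   | no ev≢t = v , realises , λ { (here ev≡t) → ev≢t ev≡t ; (there i) → ev∉T i }
  ...   | yes refl with avoiding T (≤-trans bound≤m (m<n⇒m≤1+n (proj₁ realises)))
  ...     | w , realises′ , ew∉T = w , Realises-mono (m<n⇒m≤1+n (proj₁ realises)) realises′ , λ
      { (here ew≡ev) → proj₁ (e-N v w (realisers-N bound≤m realises realises′)) (sym ew≡ev)
      ; (there i)    → ew∉T i }

  extend : IsPartialIso P → InjectiveOn e (ran P) →
    ∃[ Q ] IsPartialIso Q × InjectiveOn e (ran Q) × P ⊆ Q × ∃[ v ] (u , v) ∈ Q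
  extend iso inj with u ∈? dom P | avoiding (map e (ran P)) ≤-refl
  ... | yes u∈ | _                  = P , iso , inj , id , ∈-dom u∈
  ... | no  u∉ | v , realises , ev∉ =
    (u , v) ∷ P , realiser-extends iso u∉ ≤-refl realises , InjectiveOn-∷ ev∉ inj , there , v , here refl

forth-injective : ∀ {e} → Preserves e N → ∀ {P} → IsPartialIso P → InjectiveOn e (ran P) → ∀ u →
  ∃[ Q ] IsPartialIso Q × InjectiveOn e (ran Q) × P ⊆ Q × ∃[ v ] (u , v) ∈ Q
forth-injective {e} e-N {P} iso inj u = InjectiveForth.extend e e-N P u iso inj

forth : ∀ {P} → IsPartialIso P → ∀ u → ∃[ Q ] IsPartialIso Q × P ⊆ Q × ∃[ v ] (u , v) ∈ Q
forth iso u with forth-injective (λ _ _ → id) iso (λ _ _ → id) u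
... | Q , isoQ , _ , P⊆Q , covered = Q , isoQ , P⊆Q , covered

back : ∀ {P} → IsPartialIso P → ∀ v → ∃[ Q ] IsPartialIso Q × P ⊆ Q × ∃[ u ] (u , v) ∈ Q
back iso v with forth (swap-isPartialIso iso) v
... | Q , isoQ , sub , u , i = map swap Q , swap-isPartialIso isoQ , ∈-swap ∘ sub ∘ ∈-swap , u , ∈-swap i

backAndForth : ∀ {P} → IsPartialIso P → ∀ n →
  ∃[ Q ] IsPartialIso Q × P ⊆ Q × (∃[ v ] (n , v) ∈ Q) × (∃[ u ] (u , n) ∈ Q)
backAndForth iso n with forth iso n
... | Q , isoQ , P⊆Q , v , i with back isoQ n
...   | R , isoR , Q⊆R , u , j = R , isoR , Q⊆R ∘ P⊆Q , (v , Q⊆R i) , (u , j)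

module Union {P₀ : PartialMap} (iso₀ : IsPartialIso P₀) where

  stage : ℕ → ∃ IsPartialIso
  next : ∀ n → ∃[ Q ] IsPartialIso Q × proj₁ (stage n) ⊆ Q × (∃[ v ] (n , v) ∈ Q) × (∃[ u ] (u , n) ∈ Q)

  stage zero    = P₀ , iso₀
  stage (suc n) = proj₁ (next n) , proj₁ (proj₂ (next n))

  next n = backAndForth (proj₂ (stage n)) n

  C : ℕ → PartialMap
  C n = proj₁ (stage n)

  C-mono : ∀ {m n} → m ≤′ n → C m ⊆ C n
  C-mono ≤′-refl          = id
  C-mono (≤′-step {n} m≤n) = proj₁ (proj₂ (proj₂ (next n))) ∘ C-mono m≤n

  compatible : ∀ {a b c d} i j → (a , b) ∈ C i → (c , d) ∈ C j → (a ≡ c ⇔ b ≡ d) × (E a c ⇔ E b d)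
  compatible i j p q = proj₂ (stage (i ⊔ j)) (C-mono (≤⇒≤′ (m≤m⊔n i j)) p) (C-mono (≤⇒≤′ (m≤n⊔m i j)) q)

  α α⁻¹ : V → V
  α   n = proj₁ (proj₁ (proj₂ (proj₂ (proj₂ (next n)))))
  α⁻¹ n = proj₁ (proj₂ (proj₂ (proj₂ (proj₂ (next n)))))

  α-∈ : ∀ n → (n , α n) ∈ C (suc n)
  α-∈ n = proj₂ (proj₁ (proj₂ (proj₂ (proj₂ (next n)))))

  α⁻¹-∈ : ∀ n → (α⁻¹ n , n) ∈ C (suc n)
  α⁻¹-∈ n = proj₂ (proj₂ (proj₂ (proj₂ (proj₂ (next n)))))

  α-isAut : IsAut α
  α-isAut = α⁻¹
    , (λ x → sym (from (proj₁ (compatible (suc x) (suc (α x)) (α-∈ x) (α⁻¹-∈ (α x)))) refl))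
    , (λ y → sym (to (proj₁ (compatible (suc y) (suc (α⁻¹ y)) (α⁻¹-∈ y) (α-∈ (α⁻¹ y)))) refl))
    , (λ x y → to (proj₂ (compatible (suc x) (suc y) (α-∈ x) (α-∈ y))))
    , (λ x y → from (proj₂ (compatible (suc x) (suc y) (α-∈ x) (α-∈ y))))

  α-extends : ∀ {a b} → (a , b) ∈ P₀ → α a ≡ b
  α-extends {a} i = sym (to (proj₁ (compatible 0 (suc a) i (α-∈ a))) refl)

-- Opaque because pattern matching on an unfolded extendToAut makes type checking blow up.
opaque
  extendToAut : ∀ {P} → IsPartialIso P → ∃[ α ] IsAut α × (∀ {a b} → (a , b) ∈ P → α a ≡ b)
  extendToAut iso = α , α-isAut , α-extends
    where open Union iso

edge-isPartialIso : ∀ {a b x y} → E a b → E x y → IsPartialIso ((a , x) ∷ (b , y) ∷ [])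
edge-isPartialIso Eab Exy = ∷-isPartialIso (∷-isPartialIso (λ ()) (λ ())) λ
  { (here refl) → mk⇔ (λ b≡a → ⊥-elim (E⇒≢ Eab (sym b≡a))) (λ y≡x → ⊥-elim (E⇒≢ Exy (sym y≡x)))
                , mk⇔ (λ _ → E-sym Exy) (λ _ → E-sym Eab)
  ; (there ()) }

graph-isPartialIso : ∀ {f g L} → InjectiveOn f L → InjectiveOn g L → IndependentOn f L → IndependentOn g L →
  IsPartialIso (map (λ u → f u , g u) L)
graph-isPartialIso {f} {g} injf injg indf indg p q with ∈-map⁻ _ p | ∈-map⁻ _ q
... | u , i , refl | v , j , refl =
  mk⇔ (cong g ∘ injf i j) (cong f ∘ injg i j) , mk⇔ (⊥-elim ∘ indf i j) (⊥-elim ∘ indg i j)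

module Killing {e : V → V} (e-N : Preserves e N) {x y : V} (Exy : E x y) (Nexy : N (e x) (e y)) where

  cover : ∀ L {P} → IsPartialIso P → InjectiveOn e (ran P) →
    ∃[ Q ] IsPartialIso Q × InjectiveOn e (ran Q) × P ⊆ Q × (∀ {u} → u ∈ L → ∃[ v ] (u , v) ∈ Q)
  cover []      iso inj = _ , iso , inj , id , λ ()
  cover (u ∷ L) iso inj with forth-injective e-N iso inj u
  ... | Q , isoQ , injQ , P⊆Q , v , i with cover L isoQ injQ
  ...   | R , isoR , injR , Q⊆R , covered =
    R , isoR , injR , Q⊆R ∘ P⊆Q , λ { (here refl) → v , Q⊆R i ; (there j) → covered j }

  injective₀ : InjectiveOn e (x ∷ y ∷ [])
  injective₀ = InjectiveOn-∷ (λ { (here ex≡ey) → proj₁ Nexy ex≡ey ; (there ()) }) (InjectiveOn-∷ (λ ()) (λ ()))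

  -- Send the edge a b onto x y, and the finite set L to vertices on which e is injective.
  killEdge : ∀ L {a b} → E a b → ∃[ α ] IsAut α × InjectiveOn (e ∘ α) L × ¬ E (e (α a)) (e (α b))
  killEdge L Eab with cover L (edge-isPartialIso Eab Exy) injective₀
  ... | Q , isoQ , injQ , P₀⊆Q , covered with extendToAut isoQ
  ...   | α , isAut , extends = α , isAut , injective , subst₂ (λ s t → ¬ E (e s) (e t)) αa≡x αb≡y (proj₂ Nexy)
    where
    image⊆ran : map α L ⊆ ran Q
    image⊆ran w∈ with ∈-map⁻ α w∈
    ... | u , u∈ , refl with covered u∈
    ...   | v , i = subst (_∈ ran Q) (sym (extends i)) (∈-map⁺ proj₂ i)
    injective : InjectiveOn (e ∘ α) L
    injective = InjectiveOn-∘ (λ _ _ → aut-injective isAut) (InjectiveOn-⊆ image⊆ran injQ)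
    αa≡x = sym (extends (P₀⊆Q (here refl)))
    αb≡y = sym (extends (P₀⊆Q (there (here refl))))

module Generation {e : V → V} (e-N : Preserves e N) {x y : V} (Exy : E x y) (Nexy : N (e x) (e y))
  {M : (V → V) → Set} (isMonoid : IsMonoid M) (e∈M : M e) (aut∈M : ∀ α → IsAut α → M α) where

  open Killing e-N Exy Nexy

  ∘-closed : ∀ {f g} → M f → M g → M (f ∘ g)
  ∘-closed = proj₂ isMonoid _ _

  killEdges : ∀ F R → ∃[ g ] M g × InjectiveOn g F × (∀ {u v} → (u , v) ∈ R → ¬ E (g u) (g v))
  killEdges F [] = id , proj₁ isMonoid , (λ _ _ → id) , λ ()
  killEdges F ((p , q) ∷ R) with killEdges F R
  ... | g , g∈M , injg , nonEdges with E? (g p) (g q)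
  ...   | no ¬Egpq = g , g∈M , injg , λ { (here refl) → ¬Egpq ; (there i) → nonEdges i }
  ...   | yes Egpq with killEdge (map g F) Egpq
  ...     | α , isAut , injeα , killed =
    e ∘ α ∘ g , ∘-closed (∘-closed e∈M (aut∈M α isAut)) g∈M , InjectiveOn-∘ injg injeα , λ
      { (here refl) → killed
      ; (there i)   → Preserves-∘ (N⇒NonAdjacent e-N) (N⇒NonAdjacent (aut-N isAut)) _ _ (nonEdges i) }

  independent : ∀ F → ∃[ g ] M g × InjectiveOn g F × IndependentOn g F
  independent F with killEdges F (cartesianProduct F F)
  ... | g , g∈M , injg , nonEdges = g , g∈M , injg , λ i j → nonEdges (∈-cartesianProduct⁺ i j)

  approximates : ∀ {h} → IsEN h → ∀ F → ∃[ g ] M g × All (λ u → g u ≡ h u) F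
  approximates (injh , indh) F with independent F
  ... | g , g∈M , injg , indg with extendToAut (graph-isPartialIso injg (λ _ _ → injh _ _) indg (λ _ _ → indh _ _))
  ...   | β , isAut , extends = β ∘ g , ∘-closed (aut∈M β isAut) g∈M , All.tabulate (extends ∘ ∈-map⁺ _)

lemma5 : (eN : V → V) → IsEN eN → (e : V → V) → Preserves e N →
    (Σ V λ x → Σ V λ y → E x y × ¬ E (e x) (e y)) →
    InClosedMonoidGen e eN
lemma5 eN isEN e e-N edge M isMonoid closed e∈M aut∈M with edge-to-N e-N edge
... | x , y , Exy , Nexy = closed eN (approximates isEN)
  where open Generation e-N Exy Nexy isMonoid e∈M aut∈M
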